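{- Fix $m,p\in\mathbb{N}$. Let $x=(x_i)_{i\in\mathbb{N}_0}$ and $y=(y_i)_{i\in\mathbb{N}_0}$ be non-decreasing sequences of non-negative integers. Then the following are equivalent: (i) $(x_i)_{i\in\mathbb{N}_0}$ and $(y_i)_{i\in\mathbb{N}}$ are $p$-complementary on $\mathbb{N}_0$, and $y_n-x_n=mn$ for all $n\in\mathbb{N}_0$; (ii) for all $n\in\mathbb{N}_0$, $x_n=\lfloor n\phi_{mp}/p\rfloor$ and $y_n=\lfloor n(\phi_{mp}+mp)/p\rfloor$, where $\phi_k=\frac{2-k+\sqrt{k^2+4}}{2}$.
   Context: $\mathbb{N}=\{1,2,\dots\}$, $\mathbb{N}_0=\{0,1,2,\dots\}$. Two sequences $(x_i)_{i\in Q}$, $(y_i)_{i\in R}$ of non-negative integers are $p$-complementary on $\mathbb{N}_0$ if for each $n\in\mathbb{N}_0$, $\#\{i\in Q:x_i=n\}+\#\{i\in R:y_i=n\}=p$. -}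

module Defs where

open import Data.Nat as ℕ using (ℕ; zero; suc; _+_; _*_)
open import Data.Integer as ℤ using (ℤ; +_; 0ℤ)
open import Data.List using (List; length)
open import Data.List.Membership.Propositional using (_∈_)
open import Data.List.Relation.Unary.Unique.Propositional using (Unique)
open import Data.Product using (Σ; _×_; ∃)
open import Data.Sum using (_⊎_)
open import Relation.Nullary using (¬_)
open import Relation.Binary.PropositionalEquality using (_≡_)

NonDecreasing : (ℕ → ℕ) → Set
NonDecreasing x = ∀ i j → i ℕ.≤ j → x i ℕ.≤ x j

-- #{ i ∈ ℕ₀ | P i } = c : the set of indices satisfying P is finite with
-- exactly c elements (witnessed by a duplicate-free list enumerating it).
HasCount : (ℕ → Set) → ℕ → Set
HasCount P c =
  Σ (List ℕ) λ l → Unique l × (∀ i → i ∈ l → P i) × (∀ i → P i → i ∈ l) × length l ≡ c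

-- (x_i)_{i∈ℕ₀} and (y_i)_{i∈ℕ} (i.e. indices i ≥ 1) are p-complementary on ℕ₀.
Complementary : ℕ → (ℕ → ℕ) → (ℕ → ℕ) → Set
Complementary p x y = ∀ n → ∃ λ a → ∃ λ b →
  HasCount (λ i → x i ≡ n) a × HasCount (λ i → 1 ℕ.≤ i × y i ≡ n) b × a + b ≡ p

-- LeSqrt a c D  means  a ≤ c·√D  (a ∈ ℤ, c, D ∈ ℕ), as real numbers.
LeSqrt : ℤ → ℕ → ℕ → Set
LeSqrt a c D = (a ℤ.< 0ℤ) ⊎ (a ℤ.* a ℤ.≤ + (c * c * D))

-- FloorSurd r c D t q  means  q = ⌊ (r + c·√D) / t ⌋   (t > 0), i.e.
-- t·q ≤ r + c√D  and  ¬ (t·(q+1) ≤ r + c√D).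
FloorSurd : ℤ → ℕ → ℕ → ℕ → ℕ → Set
FloorSurd r c D t q = LeSqrt (+ (t * q) ℤ.- r) c D × ¬ LeSqrt (+ (t * suc q) ℤ.- r) c D

-- φ_k = (2 - k + √(k²+4)) / 2.
-- ⌊ n φ_k / p ⌋ = ⌊ (n(2-k) + n√(k²+4)) / (2p) ⌋
FloorNPhiDivP : ℕ → ℕ → ℕ → ℕ → Set
FloorNPhiDivP k p n q = FloorSurd (+ (2 * n) ℤ.- + (k * n)) n (k * k + 4) (2 * p) q

-- ⌊ n (φ_k + k) / p ⌋ = ⌊ (n(2+k) + n√(k²+4)) / (2p) ⌋
FloorNPhiPlusKDivP : ℕ → ℕ → ℕ → ℕ → Set
FloorNPhiPlusKDivP k p n q = FloorSurd (+ (n * (2 + k))) n (k * k + 4) (2 * p) q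

module Submission where

open import Data.Nat using (ℕ; zero; suc; _+_; _*_; _∸_; _≤_; _<_; z≤n; s≤s; s≤s⁻¹; _≟_; _<?_; _≤?_)
open import Data.Nat.Properties
open import Data.Nat.Induction using (<-rec)
open import Data.Nat.Tactic.RingSolver using (solve-∀)
import Data.Integer as ℤ
import Data.Integer.Properties as ℤP
import Data.Integer.Tactic.RingSolver as ℤSolver
open import Data.Product using (Σ; _×_; _,_; proj₁; proj₂; map₂)
open import Data.Sum using (_⊎_; inj₁; inj₂; [_,_])
import Data.Sum as Sum
open import Data.Empty using (⊥-elim)
open import Data.List using (List; []; _∷_; length)
open import Data.List.Membership.Propositional using (_∈_)
open import Data.List.Membership.DecPropositional _≟_ using (_∈?_)
open import Data.List.Relation.Unary.Any using (here; there)
import Data.List.Relation.Unary.All as All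
open import Data.List.Relation.Unary.Unique.Propositional using (Unique)
open import Data.List.Relation.Unary.AllPairs using ([]; _∷_)
open import Function using (_∘_)
open import Function.Bundles using (_⇔_; mk⇔; Equivalence)
import Function.Properties.Equivalence as ⇔
open import Relation.Nullary using (¬_; Dec; yes; no)
open import Relation.Nullary.Decidable using (_×-dec_; decidable-stable)
open import Relation.Binary using (tri<; tri≈; tri>)
open import Relation.Binary.PropositionalEquality using (_≡_; _≢_; refl; sym; trans; cong; cong₂; subst; subst₂; module ≡-Reasoning)
open import Defs

open Equivalence using (to; from)

-- Strategy.  φ is an irrational root of φ² + (k-2)φ - k = 0, so 1/φ + 1/(φ+k) = 1 and the
-- Beatty partition holds:  #{n | nφ < N} + #{n ≥ 1 | n(φ+k) < N} = N  for every N.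
-- Write AgreeBelow v for "x i < v ⇔ iφ < pv for all i", i.e. x and ⌊nφ/p⌋ agree below v.
-- If y = x + m·id and AgreeBelow holds up to v, then y i < v ⇔ i(φ+k) < pv, so the
-- Beatty partition says exactly pv indices have x i < v or y i < v.  Comparing levels v
-- and v+1: complementarity at level v (p hits on the value v) is what makes
-- {i | x i < v+1} and {i | iφ < p(v+1)} initial segments of equal size, hence equal; and
-- conversely agreement at every level makes the level-v hit count p(v+1) - pv = p.

+-interchange : ∀ a b c d → (a + b) + (c + d) ≡ (a + c) + (b + d)
+-interchange = solve-∀

module Counting where

  ind : {A : Set} → Dec A → ℕ
  ind (yes _) = 1
  ind (no _)  = 0

  ind≤1 : {A : Set} (d : Dec A) → ind d ≤ 1
  ind≤1 (yes _) = s≤s z≤n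
  ind≤1 (no _)  = z≤n

  ind-yes : {A : Set} (d : Dec A) → A → ind d ≡ 1
  ind-yes (yes _) _ = refl
  ind-yes (no ¬a) a = ⊥-elim (¬a a)

  ind-no : {A : Set} (d : Dec A) → ¬ A → ind d ≡ 0
  ind-no (yes a) ¬a = ⊥-elim (¬a a)
  ind-no (no _)  _  = refl

  ind-cong : {A B : Set} (d : Dec A) (e : Dec B) → A ⇔ B → ind d ≡ ind e
  ind-cong d (yes b) A⇔B = ind-yes d (from A⇔B b)
  ind-cong d (no ¬b) A⇔B = ind-no d (¬b ∘ to A⇔B)

  ind-disjoint : {A B C : Set} (d : Dec A) (e : Dec B) (f : Dec C) →
                 C ⇔ (A ⊎ B) → (A → ¬ B) → ind f ≡ ind d + ind e
  ind-disjoint (yes a) (yes b) f C⇔A⊎B disj = ⊥-elim (disj a b)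
  ind-disjoint (yes a) (no _)  f C⇔A⊎B disj = ind-yes f (from C⇔A⊎B (inj₁ a))
  ind-disjoint (no _)  (yes b) f C⇔A⊎B disj = ind-yes f (from C⇔A⊎B (inj₂ b))
  ind-disjoint (no ¬a) (no ¬b) f C⇔A⊎B disj =
    ind-no f λ c → [ ¬a , ¬b ] (to C⇔A⊎B c)

  ind-exactlyOne : {A B : Set} (d : Dec A) (e : Dec B) → (A → ¬ B) → (¬ A → B) →
                   ind d + ind e ≡ 1
  ind-exactlyOne (yes a) e excl _    = cong suc (ind-no e (excl a))
  ind-exactlyOne (no ¬a) e _    some = ind-yes e (some ¬a)

  sumBelow : ℕ → (ℕ → ℕ) → ℕ
  sumBelow zero    f = 0
  sumBelow (suc B) f = sumBelow B f + f B

  sumBelow-cong : ∀ B {f g : ℕ → ℕ} → (∀ i → i < B → f i ≡ g i) → sumBelow B f ≡ sumBelow B g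
  sumBelow-cong zero    f≗g = refl
  sumBelow-cong (suc B) f≗g =
    cong₂ _+_ (sumBelow-cong B (λ i i<B → f≗g i (m<n⇒m<1+n i<B))) (f≗g B ≤-refl)

  sumBelow-+ : ∀ B f g → sumBelow B (λ i → f i + g i) ≡ sumBelow B f + sumBelow B g
  sumBelow-+ zero    f g = refl
  sumBelow-+ (suc B) f g rewrite sumBelow-+ B f g = +-interchange (sumBelow B f) (sumBelow B g) (f B) (g B)

  sumBelow-ones : ∀ B → sumBelow B (λ _ → 1) ≡ B
  sumBelow-ones zero    = refl
  sumBelow-ones (suc B) rewrite sumBelow-ones B = +-comm B 1

  sumBelow-zero : ∀ B f → (∀ i → i < B → f i ≡ 0) → sumBelow B f ≡ 0
  sumBelow-zero zero    f f≡0 = refl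
  sumBelow-zero (suc B) f f≡0
    rewrite sumBelow-zero B f (λ i i<B → f≡0 i (m<n⇒m<1+n i<B)) = f≡0 B ≤-refl

  sumBelow-extend : ∀ {B B'} f → B ≤ B' → (∀ i → B ≤ i → f i ≡ 0) → sumBelow B' f ≡ sumBelow B f
  sumBelow-extend {B' = zero}   f z≤n  vanish = refl
  sumBelow-extend {B} {suc B'} f B≤1+B' vanish with m≤n⇒m<n∨m≡n B≤1+B'
  ... | inj₂ refl = refl
  ... | inj₁ B<1+B' = begin
    sumBelow B' f + f B'  ≡⟨ cong₂ _+_ (sumBelow-extend f B≤B' vanish) (vanish B' B≤B') ⟩
    sumBelow B f + 0      ≡⟨ +-identityʳ _ ⟩
    sumBelow B f          ∎
    where
      open ≡-Reasoning
      B≤B' = s≤s⁻¹ B<1+B'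

  sumBelow-shift : ∀ B f → sumBelow (suc B) f ≡ f 0 + sumBelow B (f ∘ suc)
  sumBelow-shift zero    f = +-comm 0 (f 0)
  sumBelow-shift (suc B) f rewrite sumBelow-shift B f = +-assoc (f 0) _ _

  sumBelow-reverse : ∀ B f → sumBelow B f ≡ sumBelow B (λ i → f (B ∸ suc i))
  sumBelow-reverse zero    f = refl
  sumBelow-reverse (suc B) f = begin
    sumBelow B f + f B                          ≡⟨ cong (_+ f B) (sumBelow-reverse B f) ⟩
    sumBelow B (λ i → f (B ∸ suc i)) + f B      ≡⟨ +-comm _ (f B) ⟩
    f B + sumBelow B (λ i → f (B ∸ suc i))      ≡⟨ sym (sumBelow-shift B (λ i → f (B ∸ i))) ⟩
    sumBelow (suc B) (λ i → f (B ∸ i))          ∎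
    where open ≡-Reasoning

  count : {P : ℕ → Set} → (∀ i → Dec (P i)) → ℕ → ℕ
  count P? B = sumBelow B (λ i → ind (P? i))

  count≤ : {P : ℕ → Set} (P? : ∀ i → Dec (P i)) (B : ℕ) → count P? B ≤ B
  count≤ P? zero    = z≤n
  count≤ P? (suc B) = subst (count P? B + ind (P? B) ≤_) (+-comm B 1)
                            (+-mono-≤ (count≤ P? B) (ind≤1 (P? B)))

  count-cong : {P Q : ℕ → Set} (P? : ∀ i → Dec (P i)) (Q? : ∀ i → Dec (Q i)) (B : ℕ) →
               (∀ i → P i ⇔ Q i) → count P? B ≡ count Q? B
  count-cong P? Q? B P⇔Q = sumBelow-cong B (λ i _ → ind-cong (P? i) (Q? i) (P⇔Q i))

  count-disjoint : {A A' A'' : ℕ → Set} (A? : ∀ i → Dec (A i)) (A'? : ∀ i → Dec (A' i)) (A''? : ∀ i → Dec (A'' i))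
                   (B : ℕ) → (∀ i → A i ⇔ (A' i ⊎ A'' i)) → (∀ i → A' i → ¬ A'' i) →
                   count A? B ≡ count A'? B + count A''? B
  count-disjoint A? A'? A''? B union disjoint =
    trans (sumBelow-cong B (λ i _ → ind-disjoint (A'? i) (A''? i) (A? i) (union i) (disjoint i))) (sumBelow-+ B _ _)

  count-extend : {P : ℕ → Set} (P? : ∀ i → Dec (P i)) → ∀ {B B'} → B ≤ B' →
                 (∀ i → P i → i < B) → count P? B' ≡ count P? B
  count-extend P? B≤B' bound =
    sumBelow-extend _ B≤B' (λ i B≤i → ind-no (P? i) (λ Pi → <⇒≱ (bound i Pi) B≤i))

  count-full : {P : ℕ → Set} (P? : ∀ i → Dec (P i)) (B : ℕ) → (∀ i → i < B → P i) → count P? B ≡ B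
  count-full P? B all = trans (sumBelow-cong B (λ i i<B → ind-yes (P? i) (all i i<B))) (sumBelow-ones B)

  DownClosed : (ℕ → Set) → Set
  DownClosed P = ∀ i j → j ≤ i → P i → P j

  count-initialBelow : {P : ℕ → Set} (P? : ∀ i → Dec (P i)) → DownClosed P →
                       ∀ B i → i < B → P i ⇔ i < count P? B
  count-initialBelow P? closed (suc B) i i<1+B with P? B
  ... | yes PB = mk⇔ (λ _ → subst (i <_) (sym full) i<1+B) (λ _ → closed B i (s≤s⁻¹ i<1+B) PB)
    where
      full : count P? B + 1 ≡ suc B
      full = trans (cong (_+ 1) (count-full P? B (λ j j<B → closed B j (<⇒≤ j<B) PB))) (+-comm B 1)
  ... | no ¬PB with m<1+n⇒m<n∨m≡n i<1+B
  ...   | inj₁ i<B = subst (λ c → _ ⇔ i < c) (sym (+-identityʳ _)) (count-initialBelow P? closed B i i<B)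
  ...   | inj₂ refl = mk⇔ (λ PB → ⊥-elim (¬PB PB))
                          (λ i<c → ⊥-elim (<⇒≱ (subst (i <_) (+-identityʳ _) i<c) (count≤ P? i)))

  count-initial : {P : ℕ → Set} (P? : ∀ i → Dec (P i)) → DownClosed P →
                  ∀ B → (∀ i → P i → i < B) → ∀ i → P i ⇔ i < count P? B
  count-initial P? closed B bound i with i <? B
  ... | yes i<B = count-initialBelow P? closed B i i<B
  ... | no i≮B  = mk⇔ (λ Pi → ⊥-elim (i≮B (bound i Pi)))
                      (λ i<c → ⊥-elim (i≮B (<-≤-trans i<c (count≤ P? B))))

  downClosed-unique : {P Q : ℕ → Set} (P? : ∀ i → Dec (P i)) (Q? : ∀ i → Dec (Q i)) →
                      DownClosed P → DownClosed Q → ∀ B → (∀ i → P i → i < B) → (∀ i → Q i → i < B) →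
                      count P? B ≡ count Q? B → ∀ i → P i ⇔ Q i
  downClosed-unique P? Q? closedP closedQ B boundP boundQ same i =
    mk⇔ (λ Pi → from (initQ i) (subst (i <_) same (to (initP i) Pi)))
        (λ Qi → from (initP i) (subst (i <_) (sym same) (to (initQ i) Qi)))
    where
      initP = count-initial P? closedP B boundP
      initQ = count-initial Q? closedQ B boundQ

open Counting

module Cardinality where

  count-singleton : ∀ B v → v < B → count (_≟ v) B ≡ 1
  count-singleton (suc B) v v<1+B with m<1+n⇒m<n∨m≡n v<1+B
  ... | inj₁ v<B rewrite count-singleton B v v<B | ind-no (B ≟ v) (<⇒≢ v<B ∘ sym) = refl
  ... | inj₂ refl rewrite sumBelow-zero B (λ i → ind (i ≟ v)) (λ i i<v → ind-no (i ≟ v) (<⇒≢ i<v))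
                        | ind-yes (v ≟ v) refl = refl

  length-count : (l : List ℕ) → Unique l → ∀ B → (∀ i → i ∈ l → i < B) → length l ≡ count (_∈? l) B
  length-count []      _           B bound = sym (sumBelow-zero B _ (λ _ _ → refl))
  length-count (v ∷ l) (v∉l ∷ uniq) B bound = begin
    suc (length l)                                     ≡⟨ cong suc (length-count l uniq B (λ i → bound i ∘ there)) ⟩
    1 + count (_∈? l) B                                ≡⟨ cong (_+ count (_∈? l) B) (sym (count-singleton B v (bound v (here refl)))) ⟩
    count (_≟ v) B + count (_∈? l) B                   ≡⟨ sym (count-disjoint (_∈? (v ∷ l)) (_≟ v) (_∈? l) B (λ _ → split) (λ _ → disjoint)) ⟩
    count (_∈? (v ∷ l)) B                              ∎
    where
      open ≡-Reasoning
      split : ∀ {i} → i ∈ v ∷ l ⇔ (i ≡ v ⊎ i ∈ l)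
      split = mk⇔ (λ { (here e) → inj₁ e ; (there i∈l) → inj₂ i∈l }) (λ { (inj₁ e) → here e ; (inj₂ i∈l) → there i∈l })
      disjoint : ∀ {i} → i ≡ v → ¬ i ∈ l
      disjoint refl i∈l = All.lookup v∉l i∈l refl

  hasCount⇒count : {P : ℕ → Set} (P? : ∀ i → Dec (P i)) {a : ℕ} → HasCount P a →
                   ∀ B → (∀ i → P i → i < B) → a ≡ count P? B
  hasCount⇒count P? (l , uniq , sound , complete , len) B bound =
    trans (sym len) (trans (length-count l uniq B (λ i → bound i ∘ sound i))
                           (count-cong (_∈? l) P? B (λ i → mk⇔ (sound i) (complete i))))

  hasCount-bounded : {P : ℕ → Set} {a : ℕ} → HasCount P a → Σ ℕ λ B → ∀ i → P i → i < B
  hasCount-bounded (l , _ , _ , complete , _) = listBound l , λ i → listBound-> l i ∘ complete i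
    where
      listBound : List ℕ → ℕ
      listBound []      = 0
      listBound (v ∷ l) = suc v + listBound l
      listBound-> : ∀ l i → i ∈ l → i < listBound l
      listBound-> (v ∷ l) i (here refl) = s≤s (m≤m+n v (listBound l))
      listBound-> (v ∷ l) i (there i∈l) = ≤-trans (listBound-> l i i∈l) (m≤n+m (listBound l) (suc v))

  enumerate : {P : ℕ → Set} → (∀ i → Dec (P i)) → ℕ → List ℕ
  enumerate P? zero = []
  enumerate P? (suc B) with P? B
  ... | yes _ = B ∷ enumerate P? B
  ... | no _  = enumerate P? B

  enumerate-sound : {P : ℕ → Set} (P? : ∀ i → Dec (P i)) (B i : ℕ) → i ∈ enumerate P? B → P i × i < B
  enumerate-sound P? (suc B) i i∈ with P? B | i∈
  ... | yes PB | here refl = PB , ≤-refl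
  ... | yes _  | there i∈' = map₂ m<n⇒m<1+n (enumerate-sound P? B i i∈')
  ... | no _   | i∈'       = map₂ m<n⇒m<1+n (enumerate-sound P? B i i∈')

  enumerate-complete : {P : ℕ → Set} (P? : ∀ i → Dec (P i)) (B i : ℕ) → P i → i < B → i ∈ enumerate P? B
  enumerate-complete P? (suc B) i Pi i<1+B with P? B | m<1+n⇒m<n∨m≡n i<1+B
  ... | yes _  | inj₁ i<B  = there (enumerate-complete P? B i Pi i<B)
  ... | yes _  | inj₂ refl = here refl
  ... | no _   | inj₁ i<B  = enumerate-complete P? B i Pi i<B
  ... | no ¬PB | inj₂ refl = ⊥-elim (¬PB Pi)

  enumerate-unique : {P : ℕ → Set} (P? : ∀ i → Dec (P i)) (B : ℕ) → Unique (enumerate P? B)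
  enumerate-unique P? zero = []
  enumerate-unique P? (suc B) with P? B
  ... | yes _ = All.tabulate (λ {i} i∈ B≡i → <-irrefl (sym B≡i) (proj₂ (enumerate-sound P? B i i∈)))
                ∷ enumerate-unique P? B
  ... | no _  = enumerate-unique P? B

  enumerate-length : {P : ℕ → Set} (P? : ∀ i → Dec (P i)) (B : ℕ) → length (enumerate P? B) ≡ count P? B
  enumerate-length P? zero = refl
  enumerate-length P? (suc B) with P? B
  ... | yes _ = trans (cong suc (enumerate-length P? B)) (+-comm 1 _)
  ... | no _  = trans (enumerate-length P? B) (sym (+-identityʳ _))

  count⇒hasCount : {P : ℕ → Set} (P? : ∀ i → Dec (P i)) (B : ℕ) → (∀ i → P i → i < B) → HasCount P (count P? B)
  count⇒hasCount P? B bound =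
    enumerate P? B , enumerate-unique P? B , (λ i → proj₁ ∘ enumerate-sound P? B i) ,
    (λ i Pi → enumerate-complete P? B i Pi (bound i Pi)) , enumerate-length P? B

open Cardinality

-- X ≤ Y as soon as X + Z ≡ Y for some Z: turns a ring identity into an inequality.
≤-by : ∀ X Y Z → X + Z ≡ Y → X ≤ Y
≤-by X Y Z X+Z≡Y = subst (X ≤_) X+Z≡Y (m≤m+n X Z)

-- Transfer a strict inequality along an identity  X + Y' ≡ X' + Y  (i.e. Y - X = Y' - X').
<-transfer : ∀ {X Y X' Y'} → X + Y' ≡ X' + Y → X < Y → X' < Y'
<-transfer {X} {Y} {X'} {Y'} eq X<Y =
  +-cancelʳ-< Y X' Y' (subst₂ _<_ eq (+-comm Y Y') (+-monoˡ-< Y' X<Y))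

<-from-offset : ∀ {a b c d} → a < b → c + b ≤ d + a → c < d
<-from-offset {a} {b} {c} {d} a<b le = +-cancelʳ-< a c d (<-≤-trans (+-monoʳ-< c a<b) le)

-- The Beatty partition for φ = φ_k, k ≥ 1, the positive root of φ² + (k-2)φ - k = 0.
-- Since 1/φ + 1/(φ+k) = 1 and φ is irrational, the sequences ⌊nφ⌋ (n ≥ 0) and
-- ⌊n(φ+k)⌋ (n ≥ 1) together take every value exactly once; counted below N:
--   #{n | nφ < N} + #{n ≥ 1 | n(φ+k) < N} = N.
-- Everything is phrased through the integer inequality  Below N n  ⇔  nφ < N.
module Beatty (k' : ℕ) where

  k : ℕ
  k = suc k'

  -- nφ < N, i.e.  N/n > φ, i.e.  N² + (k-2)Nn - kn² > 0.
  Below : ℕ → ℕ → Set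
  Below N n = 2 * N * n + k * n * n < N * N + k * N * n

  Below? : ∀ N n → Dec (Below N n)
  Below? N n = _ <? _

  -- n(φ+k) < N  (for n ≥ 1), i.e.  nφ < N - kn.
  BelowShift : ℕ → ℕ → Set
  BelowShift N n = 1 ≤ n × Below (N ∸ k * n) n

  BelowShift? : ∀ N n → Dec (BelowShift N n)
  BelowShift? N n = (1 ≤? n) ×-dec Below? (N ∸ k * n) n

  below-zero : ∀ n → ¬ Below 0 n
  below-zero n = n≮0 ∘ subst (2 * 0 * n + k * n * n <_) (vanish k n)
    where
      vanish : ∀ k n → 0 * 0 + k * 0 * n ≡ 0
      vanish = solve-∀

  -- nφ < N forces n < N, since φ ≥ 1.
  below⇒< : ∀ {N n} → Below N n → n < N
  below⇒< {N} {n} below with n <? N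
  ... | yes n<N = n<N
  ... | no n≮N with m≤n⇒∃[o]m+o≡n {N} {n} (≮⇒≥ n≮N)
  ...   | d , refl = ⊥-elim (<⇒≱ below (≤-by _ _ (N * N + 2 * N * d + k * N * d + k * d * d) (identity k N d)))
    where
      identity : ∀ k N d → N * N + k * N * (N + d) + (N * N + 2 * N * d + k * N * d + k * d * d)
                         ≡ 2 * N * (N + d) + k * (N + d) * (N + d)
      identity = solve-∀

  below-downClosed : ∀ N → DownClosed (Below N)
  below-downClosed N n zero _ below with m≤n⇒∃[o]m+o≡n {1} {N} (≤-<-trans z≤n (below⇒< below))
  ... | N' , refl = ≤-by _ _ (N' * N' + 2 * N') (identity k N')
    where
      identity : ∀ k N' → suc (2 * (1 + N') * 0 + k * 0 * 0) + (N' * N' + 2 * N') ≡ (1 + N') * (1 + N') + k * (1 + N') * 0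
      identity = solve-∀
  below-downClosed N n (suc n'') n'≤n below with m≤n⇒∃[o]m+o≡n {suc n''} {n} n'≤n
  ... | d , refl = *-cancelˡ-< n _ _ (<-from-offset {a = n' * lhs n} {b = n' * rhs n}
                     (*-monoʳ-< n' below) (≤-by _ _ (d * (N * N) + k * n * n' * d) (identity k N n' d)))
    where
      n' = suc n''
      lhs rhs : ℕ → ℕ
      lhs z = 2 * N * z + k * z * z
      rhs z = N * N + k * N * z
      identity : ∀ k N n' d → ((n' + d) * (2 * N * n' + k * n' * n') + n' * (N * N + k * N * (n' + d))) + (d * (N * N) + k * (n' + d) * n' * d)
                             ≡ (n' + d) * (N * N + k * N * n') + n' * (2 * N * (n' + d) + k * (n' + d) * (n' + d))
      identity = solve-∀

  below-mono : ∀ {N N' n} → Below N n → N ≤ N' → Below N' n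
  below-mono {N} {N'} {n} below N≤N'
    with m≤n⇒∃[o]m+o≡n {n} {N} (<⇒≤ (below⇒< below)) | m≤n⇒∃[o]m+o≡n {N} {N'} N≤N'
  ... | c , refl | e , refl = <-from-offset below (≤-by _ _ (2 * c * e + e * e + k * e * n) (identity k n c e))
    where
      identity : ∀ k n c e → (2 * (n + c + e) * n + k * n * n + ((n + c) * (n + c) + k * (n + c) * n)) + (2 * c * e + e * e + k * e * n)
                           ≡ ((n + c + e) * (n + c + e) + k * (n + c + e) * n) + (2 * (n + c) * n + k * n * n)
      identity = solve-∀

  -- Irrationality of φ:  j/i = φ+k-1 would mean  i² + kij = j², which has no
  -- solution with i ≥ 1.  Infinite descent (i, j) ↦ (j - ki, i), fuelled by i < f.
  irrational-fuel : ∀ f i j → i < f → 1 ≤ i → i * i + k * i * j ≢ j * j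
  irrational-fuel (suc f) (suc i') j i<1+f _ eq with j ≤? k * suc i'
  ... | yes j≤ki = <-irrefl (sym eq) (≤-<-trans (*-monoˡ-≤ j j≤ki) (m<n+m (k * i * j) {i * i} (s≤s z≤n)))
    where i = suc i'
  ... | no j≰ki with m≤n⇒∃[o]m+o≡n {suc (k * suc i')} {j} (≰⇒> j≰ki)
  ...   | r , refl = irrational-fuel f r' i (≤-trans r'<i (s≤s⁻¹ i<1+f)) (s≤s z≤n) (sym eq')
    where
      i = suc i'
      r' = suc r
      identity : ∀ k i r → (1 + k * i + r) * (1 + k * i + r) ≡ (1 + r) * (1 + r) + k * (1 + r) * i + k * i * (1 + k * i + r)
      identity = solve-∀
      eq' : i * i ≡ r' * r' + k * r' * i
      eq' = +-cancelʳ-≡ (k * i * (suc (k * i) + r)) (i * i) _ (trans eq (identity k i r))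
      r'<i : r' < i
      r'<i with r' <? i
      ... | yes lt = lt
      ... | no r'≮i = ⊥-elim (<⇒≱ (subst (r' * r' <_) (sym eq') (m<m+n (r' * r') (s≤s z≤n)))
                                  (*-mono-≤ (≮⇒≥ r'≮i) (≮⇒≥ r'≮i)))

  irrational : ∀ i j → 1 ≤ i → i * i + k * i * j ≢ j * j
  irrational i j = irrational-fuel (suc i) i j ≤-refl

  below-split : ∀ i j → Below (i + j) j ⇔ j * j < i * i + k * i * j
  below-split i j = mk⇔ (<-transfer (identity k i j)) (<-transfer (sym (identity k i j)))
    where
      identity : ∀ k i j → (2 * (i + j) * j + k * j * j) + (i * i + k * i * j) ≡ j * j + ((i + j) * (i + j) + k * (i + j) * j)
      identity = solve-∀

  belowShift-split : ∀ i j → 1 ≤ i → BelowShift (i + j) i ⇔ i * i + k * i * j < j * j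
  belowShift-split i j 1≤i with k' * i ≤? j
  ... | yes k'i≤j with m≤n⇒∃[o]m+o≡n {k' * i} {j} k'i≤j
  ...   | c , refl = mk⇔ (λ (_ , below) → <-transfer (identity k' i c) (subst (λ t → Below t i) (reduce c) below))
                         (λ lt → 1≤i , subst (λ t → Below t i) (sym (reduce c)) (<-transfer (sym (identity k' i c)) lt))
    where
      reduce : ∀ c → i + (k' * i + c) ∸ k * i ≡ c
      reduce c = trans (cong (_∸ (i + k' * i)) (sym (+-assoc i (k' * i) c))) (m+n∸m≡n (i + k' * i) c)
      identity : ∀ k' i c → (2 * c * i + (1 + k') * i * i) + (k' * i + c) * (k' * i + c)
                          ≡ (i * i + (1 + k') * i * (k' * i + c)) + (c * c + (1 + k') * c * i)
      identity = solve-∀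
  belowShift-split i j 1≤i | no k'i≰j = mk⇔ (λ (_ , below) → ⊥-elim (below-zero i (subst (λ t → Below t i) N-ki≡0 below)))
                       (λ lt → ⊥-elim (<⇒≱ lt j²≤))
    where
      j<k'i = ≰⇒> k'i≰j
      N-ki≡0 : i + j ∸ k * i ≡ 0
      N-ki≡0 = m≤n⇒m∸n≡0 (+-monoʳ-≤ i (<⇒≤ j<k'i))
      j²≤ : j * j ≤ i * i + k * i * j
      j²≤ = ≤-trans (*-monoˡ-≤ j (<⇒≤ j<k'i)) (≤-trans (*-monoˡ-≤ j (m≤n+m (k' * i) i)) (m≤n+m (k * i * j) (i * i)))

  belowShift⇒< : ∀ {N i} → BelowShift N i → i < N
  belowShift⇒< {N} {i} (_ , below) = <-≤-trans (below⇒< below) (m∸n≤m N (k * i))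

  -- For j < N exactly one of  jφ < N  and  (N - j)(φ+k) < N  holds: with i = N - j
  -- they read  j² < i² + kij  and  i² + kij < j², and equality is excluded by irrationality.
  below-exactlyOne : ∀ N j → j < N → ind (BelowShift? N (N ∸ j)) + ind (Below? N j) ≡ 1
  below-exactlyOne N j j<N with m≤n⇒∃[o]m+o≡n {suc j} {N} j<N
  ... | c , refl = ind-exactlyOne (BelowShift? N' (N' ∸ j)) (Below? N' j) exclusive exhaustive
    where
      i = suc c
      N' = suc j + c
      N'≡i+j : N' ≡ i + j
      N'≡i+j = trans (+-comm (suc j) c) (+-suc c j)
      N'-j≡i : N' ∸ j ≡ i
      N'-j≡i = trans (cong (_∸ j) N'≡i+j) (m+n∸n≡m i j)
      shift⇔ : BelowShift N' (N' ∸ j) ⇔ i * i + k * i * j < j * j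
      shift⇔ = subst₂ (λ M n → BelowShift M n ⇔ i * i + k * i * j < j * j) (sym N'≡i+j) (sym N'-j≡i) (belowShift-split i j (s≤s z≤n))
      below⇔ : Below N' j ⇔ j * j < i * i + k * i * j
      below⇔ = subst (λ M → Below M j ⇔ j * j < i * i + k * i * j) (sym N'≡i+j) (below-split i j)
      exclusive : BelowShift N' (N' ∸ j) → ¬ Below N' j
      exclusive shift below = <-asym (to shift⇔ shift) (to below⇔ below)
      exhaustive : ¬ BelowShift N' (N' ∸ j) → Below N' j
      exhaustive ¬shift with <-cmp (j * j) (i * i + k * i * j)
      ... | tri< lt _ _ = from below⇔ lt
      ... | tri≈ _ eq _ = ⊥-elim (irrational i j (s≤s z≤n) (sym eq))
      ... | tri> _ _ gt = ⊥-elim (¬shift (from shift⇔ gt))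

  -- Σ_{i<N} 1[i(φ+k) < N] = Σ_{j<N} 1[(N-j)(φ+k) < N], the terms i = 0 and i = N vanishing.
  countShift-reverse : ∀ N → count (BelowShift? N) N ≡ sumBelow N (λ j → ind (BelowShift? N (N ∸ j)))
  countShift-reverse N = begin
    sumBelow N shift                                 ≡⟨ sym (+-identityʳ _) ⟩
    sumBelow N shift + 0                             ≡⟨ cong (sumBelow N shift +_) (sym (ind-no (BelowShift? N N) (λ s → <-irrefl refl (belowShift⇒< s)))) ⟩
    sumBelow (suc N) shift                           ≡⟨ sumBelow-shift N shift ⟩
    shift 0 + sumBelow N (shift ∘ suc)               ≡⟨ cong (_+ sumBelow N (shift ∘ suc)) (ind-no (BelowShift? N 0) (λ { (() , _) })) ⟩
    sumBelow N (shift ∘ suc)                         ≡⟨ sumBelow-reverse N (shift ∘ suc) ⟩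
    sumBelow N (λ j → shift (suc (N ∸ suc j)))       ≡⟨ sumBelow-cong N (λ j j<N → cong shift (sym (+-∸-assoc 1 j<N))) ⟩
    sumBelow N (λ j → shift (N ∸ j))                 ∎
    where
      open ≡-Reasoning
      shift : ℕ → ℕ
      shift i = ind (BelowShift? N i)

  beattyPartition : ∀ N B → N ≤ B → count (Below? N) B + count (BelowShift? N) B ≡ N
  beattyPartition N B N≤B = begin
    count (Below? N) B + count (BelowShift? N) B
      ≡⟨ cong₂ _+_ (count-extend (Below? N) N≤B (λ _ → below⇒<)) (count-extend (BelowShift? N) N≤B (λ _ → belowShift⇒<)) ⟩
    count (Below? N) N + count (BelowShift? N) N
      ≡⟨ cong (count (Below? N) N +_) (countShift-reverse N) ⟩
    count (Below? N) N + sumBelow N (λ j → ind (BelowShift? N (N ∸ j)))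
      ≡⟨ sym (sumBelow-+ N _ _) ⟩
    sumBelow N (λ j → ind (Below? N j) + ind (BelowShift? N (N ∸ j)))
      ≡⟨ sumBelow-cong N (λ j j<N → trans (+-comm (ind (Below? N j)) _) (below-exactlyOne N j j<N)) ⟩
    sumBelow N (λ _ → 1)
      ≡⟨ sumBelow-ones N ⟩
    N ∎
    where open ≡-Reasoning

module SurdFloor where

  open ℤ using (ℤ; +_; -[1+_]; 0ℤ; _⊖_; +≤+; -<+; +<+)

  ⊖-cross : ∀ A B C D → A + D ≡ C + B → A ⊖ B ≡ C ⊖ D
  ⊖-cross A B C D A+D≡C+B = begin
    A ⊖ B              ≡⟨ sym (ℤP.+-cancelˡ-⊖ D A B) ⟩
    (D + A) ⊖ (D + B)  ≡⟨ cong₂ _⊖_ (trans (+-comm D A) (trans A+D≡C+B (+-comm C B))) (+-comm D B) ⟩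
    (B + C) ⊖ (B + D)  ≡⟨ ℤP.+-cancelˡ-⊖ B C D ⟩
    C ⊖ D              ∎
    where open ≡-Reasoning

  sub-sub≡⊖ : ∀ X Y Z → + X ℤ.- (+ Y ℤ.- + Z) ≡ (X + Z) ⊖ Y
  sub-sub≡⊖ X Y Z = begin
    + X ℤ.- (+ Y ℤ.- + Z)    ≡⟨ regroup (+ X) (+ Y) (+ Z) ⟩
    (+ X ℤ.+ + Z) ℤ.- + Y    ≡⟨ cong (ℤ._- + Y) (sym (ℤP.pos-+ X Z)) ⟩
    + (X + Z) ℤ.- + Y        ≡⟨ ℤP.[+m]-[+n]≡m⊖n (X + Z) Y ⟩
    (X + Z) ⊖ Y              ∎
    where
      open ≡-Reasoning
      regroup : ∀ (x y z : ℤ) → x ℤ.- (y ℤ.- z) ≡ (x ℤ.+ z) ℤ.- y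
      regroup = ℤSolver.solve-∀

  sub-sub≡+ : ∀ X Y Z W → X + Z ≡ W + Y → + X ℤ.- (+ Y ℤ.- + Z) ≡ + W
  sub-sub≡+ X Y Z W eq = trans (sub-sub≡⊖ X Y Z) (trans (⊖-cross (X + Z) Y W 0 (trans (+-identityʳ _) eq)) (ℤP.⊖-≥ z≤n))

  sub-sub-sign : ∀ X Y Z → (+ X ℤ.- (+ Y ℤ.- + Z) ≡ + (X + Z ∸ Y)) ⊎ (+ X ℤ.- (+ Y ℤ.- + Z) ℤ.< 0ℤ)
  sub-sub-sign X Y Z with Y ≤? X + Z
  ... | yes Y≤X+Z = inj₁ (trans (sub-sub≡⊖ X Y Z) (ℤP.⊖-≥ Y≤X+Z))
  ... | no Y≰X+Z  = inj₂ (subst (ℤ._< 0ℤ) (sym (trans (sub-sub≡⊖ X Y Z) (ℤP.⊖-< Y>X+Z)))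
                                (ℤP.neg-mono-< (+<+ (m<n⇒0<n∸m Y>X+Z))))
    where Y>X+Z = ≰⇒> Y≰X+Z

  leSqrt-+ : ∀ A c D → LeSqrt (+ A) c D ⇔ A * A ≤ c * c * D
  leSqrt-+ A c D = mk⇔ to' (λ le → inj₂ (subst (ℤ._≤ + (c * c * D)) (ℤP.pos-* A A) (+≤+ le)))
    where
      to' : LeSqrt (+ A) c D → A * A ≤ c * c * D
      to' (inj₁ (+<+ ()))
      to' (inj₂ sq) with subst (ℤ._≤ + (c * c * D)) (sym (ℤP.pos-* A A)) sq
      ... | +≤+ le = le

  leSqrt-mono : ∀ {a a' c D} → a' ℤ.≤ a → LeSqrt a c D → LeSqrt a' c D
  leSqrt-mono a'≤a (inj₁ a<0) = inj₁ (ℤP.≤-<-trans a'≤a a<0)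
  leSqrt-mono {a' = -[1+ _ ]} _ (inj₂ _) = inj₁ -<+
  leSqrt-mono {+ a} {+ a'} {c} {D} (+≤+ a'≤a) (inj₂ sq) =
    inj₂ (ℤP.≤-trans (subst₂ ℤ._≤_ (ℤP.pos-* a' a') (ℤP.pos-* a a) (+≤+ (*-mono-≤ a'≤a a'≤a))) sq)

  floorSurd-unique : ∀ {r c D t q q'} → FloorSurd r c D t q → FloorSurd r c D t q' → q ≡ q'
  floorSurd-unique {r} {c} {D} {t} {q} {q'} (le , not-le) (le' , not-le') with <-cmp q q'
  ... | tri< q<q' _ _ = ⊥-elim (not-le (leSqrt-mono {c = c} {D = D} (ℤP.+-monoˡ-≤ (ℤ.- r) (+≤+ (*-monoʳ-≤ t q<q'))) le'))
  ... | tri≈ _ q≡q' _ = q≡q'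
  ... | tri> _ _ q>q' = ⊥-elim (not-le' (leSqrt-mono {c = c} {D = D} (ℤP.+-monoˡ-≤ (ℤ.- r) (+≤+ (*-monoʳ-≤ t q>q'))) le))

  -- ⌊n(φ_k + k)/p⌋ = ⌊nφ_k/p⌋ + mn  when k = mp: the two surds differ by the integer mn.
  floor-shift : ∀ m p n q → FloorNPhiDivP (m * p) p n q → FloorNPhiPlusKDivP (m * p) p n (q + m * n)
  floor-shift m p n q (le , not-le) =
    subst (λ a → LeSqrt a n D) (sym (same q)) le , not-le ∘ subst (λ a → LeSqrt a n D) (same (suc q))
    where
      D = m * p * (m * p) + 4
      identity : ∀ m p q n → 2 * p * (q + m * n) + 2 * n ≡ (2 * p * q + m * p * n) + n * (2 + m * p)
      identity = solve-∀
      same : ∀ q → + (2 * p * (q + m * n)) ℤ.- + (n * (2 + m * p)) ≡ + (2 * p * q) ℤ.- (+ (2 * n) ℤ.- + (m * p * n))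
      same q = begin
        + (2 * p * (q + m * n)) ℤ.- + (n * (2 + m * p))
          ≡⟨ ℤP.[+m]-[+n]≡m⊖n (2 * p * (q + m * n)) (n * (2 + m * p)) ⟩
        (2 * p * (q + m * n)) ⊖ (n * (2 + m * p))
          ≡⟨ ⊖-cross (2 * p * (q + m * n)) (n * (2 + m * p)) (2 * p * q + m * p * n) (2 * n) (identity m p q n) ⟩
        (2 * p * q + m * p * n) ⊖ (2 * n)
          ≡⟨ sym (sub-sub≡⊖ (2 * p * q) (2 * n) (m * p * n)) ⟩
        + (2 * p * q) ℤ.- (+ (2 * n) ℤ.- + (m * p * n)) ∎
        where open ≡-Reasoning

module FloorBelow (k' : ℕ) where

  open ℤ using (ℤ; +_)

  open Beatty k'
  open SurdFloor

  D : ℕ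
  D = k * k + 4

  -- n(2 - k), the rational part of 2nφ.
  r : ℕ → ℤ
  r n = + (2 * n) ℤ.- + (k * n)

  -- 2M ≤ n(2-k) + n√D, i.e. M ≤ nφ, is the negation of nφ < M.
  -- With M = n + e this is  (2e + kn)² ≤ n²(k² + 4)  against  Below (n + e) n.
  leSqrt⇔¬below : ∀ M n → LeSqrt (+ (2 * M) ℤ.- r n) n D ⇔ (¬ Below M n)
  leSqrt⇔¬below M n = mk⇔ (λ le below → below⇒¬leSqrt {M} below le) (¬below⇒leSqrt M)
    where
      W : ℕ → ℕ
      W e = 2 * e + k * n
      value : ∀ e → + (2 * (n + e)) ℤ.- r n ≡ + W e
      value e = sub-sub≡+ (2 * (n + e)) (2 * n) (k * n) (W e) (rearrange k n e)
        where
          rearrange : ∀ k n e → 2 * (n + e) + k * n ≡ (2 * e + k * n) + 2 * n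
          rearrange = solve-∀
      identity : ∀ k n e → (2 * e + k * n) * (2 * e + k * n) + 4 * (2 * (n + e) * n + k * n * n)
                         ≡ n * n * (k * k + 4) + 4 * ((n + e) * (n + e) + k * (n + e) * n)
      identity = solve-∀
      below⇒¬leSqrt : ∀ {M} → Below M n → ¬ LeSqrt (+ (2 * M) ℤ.- r n) n D
      below⇒¬leSqrt {M} below le with m≤n⇒∃[o]m+o≡n {n} {M} (<⇒≤ (below⇒< below))
      ... | e , refl = <⇒≱ (<-from-offset (*-monoʳ-< 4 below) (≤-reflexive (sym (identity k n e))))
                           (to (leSqrt-+ (W e) n D) (subst (λ a → LeSqrt a n D) (value e) le))
      ¬below⇒leSqrt : ∀ M → ¬ Below M n → LeSqrt (+ (2 * M) ℤ.- r n) n D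
      ¬below⇒leSqrt M ¬below with n <? M
      ... | yes n<M with m≤n⇒∃[o]m+o≡n {n} {M} (<⇒≤ n<M)
      ...   | e , refl = subst (λ a → LeSqrt a n D) (sym (value e)) (from (leSqrt-+ (W e) n D)
                (+-cancelʳ-≤ _ (W e * W e) (n * n * D)
                   (≤-trans (≤-reflexive (identity k n e)) (+-monoʳ-≤ (n * n * D) (*-monoʳ-≤ 4 (≮⇒≥ ¬below))))))
      ¬below⇒leSqrt M ¬below | no n≮M with sub-sub-sign (2 * M) (2 * n) (k * n)
      ... | inj₂ negative = inj₁ negative
      ... | inj₁ value≡A = subst (λ a → LeSqrt a n D) (sym value≡A) (from (leSqrt-+ A n D)
              (≤-trans (*-mono-≤ A≤kn A≤kn) (≤-by _ _ (n * n * 4) (square k n))))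
        where
          A = 2 * M + k * n ∸ 2 * n
          -- M ≤ n, so 2M - 2n + kn ≤ kn ≤ n√D.
          A≤kn : A ≤ k * n
          A≤kn = m≤n+o⇒m∸n≤o (2 * M + k * n) (2 * n) (+-monoˡ-≤ (k * n) (*-monoʳ-≤ 2 (≮⇒≥ n≮M)))
          square : ∀ k n → k * n * (k * n) + n * n * 4 ≡ n * n * (k * k + 4)
          square = solve-∀

  floor⇔below : ∀ p n q → FloorNPhiDivP k p n q ⇔ (¬ Below (p * q) n × Below (p * suc q) n)
  floor⇔below p n q = mk⇔
    (λ (le , not-le) → to (at q) le , decidable-stable (Below? (p * suc q) n) (not-le ∘ from (at (suc q))))
    (λ (¬below , below) → from (at q) ¬below , λ le → to (at (suc q)) le below)
    where
      at : ∀ q → LeSqrt (+ (2 * p * q) ℤ.- r n) n D ⇔ (¬ Below (p * q) n)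
      at q = subst (λ T → LeSqrt (+ T ℤ.- r n) n D ⇔ (¬ Below (p * q) n)) (sym (*-assoc 2 p q))
                   (leSqrt⇔¬below (p * q) n)

module Main (m' p' : ℕ) (x y : ℕ → ℕ) where

  m p k' : ℕ
  m = suc m'
  p = suc p'
  -- chosen so that k = suc k' is definitionally m * p
  k' = p' + m' * p

  open Beatty k'
  open FloorBelow k'
  open SurdFloor

  AgreeBelow : ℕ → Set
  AgreeBelow v = ∀ i → x i < v ⇔ Below (p * v) i

  agreeBelow-zero : AgreeBelow 0
  agreeBelow-zero i = mk⇔ (λ ()) (⊥-elim ∘ below-zero i ∘ subst (λ N → Below N i) (*-zeroʳ p))

  XBelow? : ∀ v i → Dec (x i < v)
  XBelow? v i = x i <? v

  YBelow? : ∀ v i → Dec (1 ≤ i × y i < v)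
  YBelow? v i = (1 ≤? i) ×-dec (y i <? v)

  XAt? : ∀ v i → Dec (x i ≡ v)
  XAt? v i = x i ≟ v

  YAt? : ∀ v i → Dec (1 ≤ i × y i ≡ v)
  YAt? v i = (1 ≤? i) ×-dec (y i ≟ v)

  count-levels : ∀ B v → count (XBelow? (suc v)) B + count (YBelow? (suc v)) B
                         ≡ (count (XBelow? v) B + count (YBelow? v) B) + (count (XAt? v) B + count (YAt? v) B)
  count-levels B v = begin
    count (XBelow? (suc v)) B + count (YBelow? (suc v)) B
      ≡⟨ cong₂ _+_ (count-disjoint (XBelow? (suc v)) (XBelow? v) (XAt? v) B (λ _ → <suc⇔) (λ _ → <⇒≢))
                   (count-disjoint (YBelow? (suc v)) (YBelow? v) (YAt? v) B yLevels yDisjoint) ⟩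
    (count (XBelow? v) B + count (XAt? v) B) + (count (YBelow? v) B + count (YAt? v) B)
      ≡⟨ +-interchange (count (XBelow? v) B) (count (XAt? v) B) (count (YBelow? v) B) (count (YAt? v) B) ⟩
    (count (XBelow? v) B + count (YBelow? v) B) + (count (XAt? v) B + count (YAt? v) B) ∎
    where
      open ≡-Reasoning
      <suc⇔ : ∀ {a} → a < suc v ⇔ (a < v ⊎ a ≡ v)
      <suc⇔ = mk⇔ m<1+n⇒m<n∨m≡n (λ { (inj₁ a<v) → m<n⇒m<1+n a<v ; (inj₂ refl) → ≤-refl })
      yLevels : ∀ i → (1 ≤ i × y i < suc v) ⇔ ((1 ≤ i × y i < v) ⊎ (1 ≤ i × y i ≡ v))
      yLevels i = mk⇔ (λ (1≤i , y<) → Sum.map (1≤i ,_) (1≤i ,_) (to <suc⇔ y<))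
                      (λ { (inj₁ (1≤i , y<v)) → 1≤i , from <suc⇔ (inj₁ y<v) ; (inj₂ (1≤i , y≡v)) → 1≤i , from <suc⇔ (inj₂ y≡v) })
      yDisjoint : ∀ i → (1 ≤ i × y i < v) → ¬ (1 ≤ i × y i ≡ v)
      yDisjoint i (_ , y<v) (_ , y≡v) = <⇒≢ y<v y≡v

  module Shifted (y≡ : ∀ n → y n ≡ x n + m * n) where

    -- y takes the value v only at indices i ≤ v, because y i ≥ mi ≥ i.
    yAt-bound : ∀ v i → (1 ≤ i × y i ≡ v) → i < suc v
    yAt-bound v i (_ , y≡v) =
      s≤s (≤-trans (m≤n*m i m) (≤-trans (m≤n+m (m * i) (x i)) (≤-reflexive (trans (sym (y≡ i)) y≡v))))

    -- For i ≥ 1 the level V - mi is strictly below V.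
    agreeBelow-shifted : ∀ V i → 1 ≤ i → (∀ w → w < V → AgreeBelow w) → AgreeBelow (V ∸ m * i)
    agreeBelow-shifted zero    (suc i) _ _     = agreeBelow-zero
    agreeBelow-shifted (suc V) (suc i) _ agree = agree (V ∸ (i + m' * suc i)) (s≤s (m∸n≤m V (i + m' * suc i)))

    -- If x agrees with ⌊nφ/p⌋ below every w < V, then  y i < V  ⇔  i(φ+k) < pV  (i ≥ 1):
    -- y i < V ⇔ x i < V - mi ⇔ iφ < p(V - mi) = pV - ki.
    yBelow⇔belowShift : ∀ V → (∀ w → w < V → AgreeBelow w) → ∀ i → (1 ≤ i × y i < V) ⇔ BelowShift (p * V) i
    yBelow⇔belowShift V agree i =
      mk⇔ (λ (1≤i , y<V) → 1≤i , to (shifted 1≤i) y<V) (λ (1≤i , below) → 1≤i , from (shifted 1≤i) below)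
      where
        p[V∸mi] : p * (V ∸ m * i) ≡ p * V ∸ k * i
        p[V∸mi] = trans (*-distribˡ-∸ p V (m * i)) (cong (p * V ∸_) (reassociate m p i))
          where
            reassociate : ∀ m p i → p * (m * i) ≡ m * p * i
            reassociate = solve-∀
        y<⇔x< : y i < V ⇔ x i < V ∸ m * i
        y<⇔x< = mk⇔ (λ y<V → m+n≤o⇒m≤o∸n (suc (x i)) (subst (_< V) (y≡ i) y<V))
                    (λ x<V∸mi → subst (_< V) (sym (y≡ i)) (+<∸ x<V∸mi))
          where
            +<∸ : ∀ {a b c} → a < c ∸ b → a + b < c
            +<∸ {a} {b} {c} a<c∸b with b ≤? c
            ... | yes b≤c = m≤o∸n⇒m+n≤o (suc a) b≤c a<c∸b
            ... | no b≰c  = ⊥-elim (n≮0 (subst (a <_) (m≤n⇒m∸n≡0 (<⇒≤ (≰⇒> b≰c))) a<c∸b))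
        shifted : 1 ≤ i → y i < V ⇔ Below (p * V ∸ k * i) i
        shifted 1≤i = ⇔.trans y<⇔x< (subst (λ N → x i < V ∸ m * i ⇔ Below N i) p[V∸mi]
                                           (agreeBelow-shifted V i 1≤i agree i))

    count-below : ∀ V → (∀ w → w ≤ V → AgreeBelow w) → ∀ B → p * V ≤ B →
                  count (XBelow? V) B + count (YBelow? V) B ≡ p * V
    count-below V agree B pV≤B =
      trans (cong₂ _+_ (count-cong (XBelow? V) (Below? (p * V)) B (agree V ≤-refl))
                       (count-cong (YBelow? V) (BelowShift? (p * V)) B
                                   (yBelow⇔belowShift V (λ w w<V → agree w (<⇒≤ w<V)))))
            (beattyPartition (p * V) B pV≤B)

    count-nextLevel : ∀ v → (∀ w → w ≤ v → AgreeBelow w) → ∀ B → p * v ≤ B →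
                      count (XBelow? (suc v)) B + count (YBelow? (suc v)) B ≡ p * v + (count (XAt? v) B + count (YAt? v) B)
    count-nextLevel v agree B pv≤B =
      trans (count-levels B v) (cong (_+ (count (XAt? v) B + count (YAt? v) B)) (count-below v agree B pv≤B))

  module FromComplementary (x-mono : NonDecreasing x) (compl : Complementary p x y)
                           (y≡ : ∀ n → y n ≡ x n + m * n) where

    open Shifted y≡

    -- Agreement up to level v and complementarity at level v give agreement below v+1:
    -- both {i | x i < v+1} and {i | iφ < p(v+1)} are initial segments of the same size.
    agreeBelow-step : ∀ v → (∀ w → w ≤ v → AgreeBelow w) → AgreeBelow (suc v)
    agreeBelow-step v agree with compl v
    ... | a , b , xAt , yAt , a+b≡p =
      downClosed-unique (XBelow? (suc v)) (Below? (p * suc v))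
                        (λ i j j≤i x<1+v → ≤-<-trans (x-mono j i j≤i) x<1+v) (below-downClosed (p * suc v))
                        B xBelow<B (λ i below → <-≤-trans (below⇒< below) p[1+v]≤B) same-count
      where
        b₀ = proj₁ (hasCount-bounded xAt)
        B = b₀ + (p * suc v + suc v)
        p[1+v]≤B : p * suc v ≤ B
        p[1+v]≤B = ≤-trans (m≤m+n (p * suc v) (suc v)) (m≤n+m _ b₀)
        xAt<B : ∀ i → x i ≡ v → i < B
        xAt<B i x≡v = ≤-trans (proj₂ (hasCount-bounded xAt) i x≡v) (m≤m+n b₀ _)
        xBelow<B : ∀ i → x i < suc v → i < B
        xBelow<B i x<1+v with m<1+n⇒m<n∨m≡n x<1+v
        ... | inj₁ x<v = <-≤-trans (below⇒< (to (agree v ≤-refl i) x<v)) (≤-trans (*-monoʳ-≤ p (n≤1+n v)) p[1+v]≤B)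
        ... | inj₂ x≡v = xAt<B i x≡v
        yAt<B : ∀ i → (1 ≤ i × y i ≡ v) → i < B
        yAt<B i y≡v = ≤-trans (yAt-bound v i y≡v) (≤-trans (m≤n+m (suc v) (p * suc v)) (m≤n+m _ b₀))
        levels : count (XAt? v) B + count (YAt? v) B ≡ p
        levels = trans (sym (cong₂ _+_ (hasCount⇒count (XAt? v) xAt B xAt<B) (hasCount⇒count (YAt? v) yAt B yAt<B)))
                       a+b≡p
        same-count : count (XBelow? (suc v)) B ≡ count (Below? (p * suc v)) B
        same-count = +-cancelʳ-≡ (count (YBelow? (suc v)) B) _ _ (begin
          count (XBelow? (suc v)) B + count (YBelow? (suc v)) B
            ≡⟨ count-nextLevel v agree B (≤-trans (*-monoʳ-≤ p (n≤1+n v)) p[1+v]≤B) ⟩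
          p * v + (count (XAt? v) B + count (YAt? v) B)
            ≡⟨ cong (p * v +_) levels ⟩
          p * v + p
            ≡⟨ trans (+-comm (p * v) p) (sym (*-suc p v)) ⟩
          p * suc v
            ≡⟨ sym (beattyPartition (p * suc v) B p[1+v]≤B) ⟩
          count (Below? (p * suc v)) B + count (BelowShift? (p * suc v)) B
            ≡⟨ cong (count (Below? (p * suc v)) B +_)
                    (sym (count-cong (YBelow? (suc v)) (BelowShift? (p * suc v)) B
                                     (yBelow⇔belowShift (suc v) (λ w w<1+v → agree w (s≤s⁻¹ w<1+v))))) ⟩
          count (Below? (p * suc v)) B + count (YBelow? (suc v)) B ∎)
          where open ≡-Reasoning

    agreeBelow-all : ∀ v → AgreeBelow v
    agreeBelow-all = <-rec AgreeBelow agree-upto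
      where
        agree-upto : ∀ v → (∀ {w} → w < v → AgreeBelow w) → AgreeBelow v
        agree-upto zero    _  = agreeBelow-zero
        agree-upto (suc v) ih = agreeBelow-step v (λ w w≤v → ih (s≤s w≤v))

    -- Agreement at the levels x n and x n + 1 pins down x n = ⌊nφ/p⌋.
    floors : ∀ n → FloorNPhiDivP (m * p) p n (x n) × FloorNPhiPlusKDivP (m * p) p n (y n)
    floors n = x-floor , subst (FloorNPhiPlusKDivP (m * p) p n) (sym (y≡ n)) (floor-shift m p n (x n) x-floor)
      where
        x-floor : FloorNPhiDivP (m * p) p n (x n)
        x-floor = from (floor⇔below p n (x n))
          ( <-irrefl refl ∘ from (agreeBelow-all (x n) n)
          , to (agreeBelow-all (suc (x n)) n) ≤-refl )

  module FromFloors (floors : ∀ n → FloorNPhiDivP (m * p) p n (x n) × FloorNPhiPlusKDivP (m * p) p n (y n)) where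

    y≡ : ∀ n → y n ≡ x n + m * n
    y≡ n = floorSurd-unique {r = ℤ.+ (n * (2 + m * p))} {c = n} {D = m * p * (m * p) + 4} {t = 2 * p}
                            (proj₂ (floors n)) (floor-shift m p n (x n) (proj₁ (floors n)))

    open Shifted y≡

    -- pq ≤ iφ < p(q+1) for q = x i, and Below is monotone in its bound.
    agreeBelow-all : ∀ v → AgreeBelow v
    agreeBelow-all v i = mk⇔ (λ x<v → below-mono below-next (*-monoʳ-≤ p x<v)) agree-from
      where
        below-next : Below (p * suc (x i)) i
        below-next = proj₂ (to (floor⇔below p i (x i)) (proj₁ (floors i)))
        agree-from : Below (p * v) i → x i < v
        agree-from below with x i <? v
        ... | yes x<v = x<v
        ... | no x≮v = ⊥-elim (proj₁ (to (floor⇔below p i (x i)) (proj₁ (floors i)))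
                                      (below-mono below (*-monoʳ-≤ p (≮⇒≥ x≮v))))

    -- The number of hits on the value v is p(v+1) - pv = p.
    complementary : Complementary p x y
    complementary v =
      count (XAt? v) B , count (YAt? v) B , count⇒hasCount (XAt? v) B xAt<B , count⇒hasCount (YAt? v) B yAt<B ,
      +-cancelˡ-≡ (p * v) _ _ (begin
        p * v + (count (XAt? v) B + count (YAt? v) B)
          ≡⟨ sym (count-nextLevel v (λ w _ → agreeBelow-all w) B pv≤B) ⟩
        count (XBelow? (suc v)) B + count (YBelow? (suc v)) B
          ≡⟨ count-below (suc v) (λ w _ → agreeBelow-all w) B p[1+v]≤B ⟩
        p * suc v
          ≡⟨ trans (*-suc p v) (+-comm p (p * v)) ⟩
        p * v + p ∎)
      where
        open ≡-Reasoning
        B = p * suc v + suc v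
        p[1+v]≤B : p * suc v ≤ B
        p[1+v]≤B = m≤m+n (p * suc v) (suc v)
        pv≤B : p * v ≤ B
        pv≤B = ≤-trans (*-monoʳ-≤ p (n≤1+n v)) p[1+v]≤B
        xAt<B : ∀ i → x i ≡ v → i < B
        xAt<B i x≡v = <-≤-trans (below⇒< (to (agreeBelow-all (suc v) i) (s≤s (≤-reflexive x≡v)))) p[1+v]≤B
        yAt<B : ∀ i → (1 ≤ i × y i ≡ v) → i < B
        yAt<B i y≡v = <-≤-trans (yAt-bound v i y≡v) (m≤n+m (suc v) (p * suc v))

theorem4p1 : (m p : ℕ) → 1 ≤ m → 1 ≤ p → (x y : ℕ → ℕ) →
    NonDecreasing x → NonDecreasing y →
    ((Complementary p x y × (∀ n → y n ≡ x n + m * n)) ⇔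
     (∀ n → FloorNPhiDivP (m * p) p n (x n) × FloorNPhiPlusKDivP (m * p) p n (y n)))
theorem4p1 (suc m') (suc p') _ _ x y x-mono _ =
  mk⇔ (λ (compl , y≡) → FromComplementary.floors x-mono compl y≡)
      (λ floors → FromFloors.complementary floors , FromFloors.y≡ floors)
  where open Main m' p' x y
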